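{- Let $F$ be a finite field, $q$ a non-degenerate quadratic form on the $F$-vector space $V$, and $a\in\widetilde{\mathsf D}(q)$. For $k\in\{1,2\}$ let $c_k$ be the number of cycles of length $3$ in $\mathcal{G}_{q,a}$ of the form $(0,v,w,0)$ with $\dim\operatorname{span}(v,w)=k$. Then the number of all cycles of length $3$ in $\mathcal{G}_{q,a}$ equals $(c_1+c_2)\cdot\frac{|V|}{3}$.
   Context: A quadratic form on a finite-dimensional $F$-vector space $V$ is a map $q:V\to F$ with $q(\lambda x)=\lambda^2q(x)$ such that $b_q(x,y)=q(x+y)-q(x)-q(y)$ is bilinear; non-degenerate means $\{x: b_q(x,y)=0\ \forall y\}=\{0\}$. $q$ is isotropic if $q(v)=0$ for some $v\ne0$. $\mathsf D(q)=\{q(v):v\in V\}\cap F^\ast$; $\widetilde{\mathsf D}(q)=\mathsf D(q)\cup\{0\}$ if $q$ is isotropic and $=\mathsf D(q)$ otherwise. The representation graph $\mathcal{G}_{q,a}$ has vertex set $V$, with distinct $x,y$ adjacent iff $q(x-y)=a$. Cycles of length 3 are triangles, counted as subgraphs (unordered vertex sets). -}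

module Defs where

open import Level using (Level; 0ℓ) renaming (suc to lsuc)
open import Data.Nat using (ℕ; zero; suc)
open import Data.Fin using (Fin) renaming (zero to fzero; suc to fsuc)
open import Data.List using (List; []; _∷_; length; filter; map; concatMap)
open import Data.List.Membership.Propositional using (_∈_)
open import Data.List.Relation.Unary.Unique.Propositional using (Unique)
open import Data.Product using (Σ; ∃; _×_; _,_)
open import Data.Sum using (_⊎_)
open import Data.Bool using (Bool; true; false; _∧_; _∨_; not)
open import Relation.Nullary using (¬_; Dec; yes; no)
open import Relation.Nullary.Decidable using (⌊_⌋)
open import Relation.Binary.PropositionalEquality using (_≡_; _≢_)
open import Algebra.Structures using (IsCommutativeRing)
import Data.Bool.ListAction

record FiniteField : Set₁ where
  infixl 7 _*_
  infixl 6 _+_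
  field
    Carrier : Set
    _+_ _*_ : Carrier → Carrier → Carrier
    -_      : Carrier → Carrier
    0# 1#   : Carrier
    isCommutativeRing : IsCommutativeRing _≡_ _+_ _*_ -_ 0# 1#
    0≢1     : 0# ≢ 1#
    inverse : ∀ x → x ≢ 0# → ∃ λ y → x * y ≡ 1#
    _≟_     : (x y : Carrier) → Dec (x ≡ y)
    elems    : List Carrier
    complete : ∀ x → x ∈ elems
    unique   : Unique elems

module _ (𝔽 : FiniteField) where
  open FiniteField 𝔽

  Vec : ℕ → Set
  Vec n = Fin n → Carrier

  zeroV : ∀ {n} → Vec n
  zeroV _ = 0#

  _+V_ : ∀ {n} → Vec n → Vec n → Vec n
  (x +V y) i = x i + y i

  _-V_ : ∀ {n} → Vec n → Vec n → Vec n
  (x -V y) i = x i + (- (y i))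

  _·V_ : ∀ {n} → Carrier → Vec n → Vec n
  (c ·V x) i = c * x i

  eqV : ∀ {n} → Vec n → Vec n → Bool
  eqV {zero}  x y = true
  eqV {suc n} x y = ⌊ x fzero ≟ y fzero ⌋ ∧ eqV {n} (λ i → x (fsuc i)) (λ i → y (fsuc i))

  cons : ∀ {n} → Carrier → Vec n → Vec (suc n)
  cons c v fzero    = c
  cons c v (fsuc i) = v i

  allVecs : ∀ n → List (Vec n)
  allVecs zero    = (λ ()) ∷ []
  allVecs (suc n) = concatMap (λ c → map (cons c) (allVecs n)) elems

  record QuadraticForm (n : ℕ) : Set where
    field
      q : Vec n → Carrier
      q-cong : ∀ x y → (∀ i → x i ≡ y i) → q x ≡ q y
      q-homog : ∀ (c : Carrier) x → q (c ·V x) ≡ (c * c) * q x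
    b : Vec n → Vec n → Carrier
    b x y = (q (x +V y) + (- q x)) + (- q y)
    field
      b-addˡ : ∀ x y z → b (x +V y) z ≡ b x z + b y z
      b-scaleˡ : ∀ c x y → b (c ·V x) y ≡ c * b x y
      b-addʳ : ∀ x y z → b x (y +V z) ≡ b x y + b x z
      b-scaleʳ : ∀ c x y → b x (c ·V y) ≡ c * b x y

  open QuadraticForm public

  NonDegenerate : ∀ {n} → QuadraticForm n → Set
  NonDegenerate Q = ∀ x → (∀ y → b Q x y ≡ 0#) → ∀ i → x i ≡ 0#

  IsNonZeroV : ∀ {n} → Vec n → Set
  IsNonZeroV x = ¬ (∀ i → x i ≡ 0#)

  Isotropic : ∀ {n} → QuadraticForm n → Set
  Isotropic Q = ∃ λ v → IsNonZeroV v × q Q v ≡ 0#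

  InD : ∀ {n} → QuadraticForm n → Carrier → Set
  InD Q a = (∃ λ v → q Q v ≡ a) × a ≢ 0#

  InD~ : ∀ {n} → QuadraticForm n → Carrier → Set
  InD~ Q a = InD Q a ⊎ (Isotropic Q × a ≡ 0#)

  module Graph {n : ℕ} (Q : QuadraticForm n) (a : Carrier) where

    adj : Vec n → Vec n → Bool
    adj x y = not (eqV x y) ∧ ⌊ q Q (x -V y) ≟ a ⌋

    isTriangle : Vec n → Vec n → Vec n → Bool
    isTriangle x y z = adj x y ∧ adj y z ∧ adj x z

    pairs : ∀ {A : Set} → List A → List (A × A)
    pairs []       = []
    pairs (x ∷ xs) = map (λ y → x , y) xs Data.List.++ pairs xs

    triples : ∀ {A : Set} → List A → List (A × A × A)
    triples []       = []
    triples (x ∷ xs) = map (λ { (y , z) → x , y , z }) (pairs xs) Data.List.++ triples xs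

    count : ∀ {A : Set} → (A → Bool) → List A → ℕ
    count p xs = length (filter (λ x → p x Data.Bool.≟ true) xs)

    -- number of triangles (3-cycles, as unordered vertex sets) of G_{q,a}:
    -- 3-element subsets of V, enumerated via the duplicate-free list allVecs n
    numTriangles : ℕ
    numTriangles = count (λ { (x , y , z) → isTriangle x y z }) (triples (allVecs n))

    independent : Vec n → Vec n → Bool
    independent v w =
      Data.Bool.ListAction.and (concatMap (λ α → map (λ β →
        not (eqV ((α ·V v) +V (β ·V w)) zeroV) ∨ (⌊ α ≟ 0# ⌋ ∧ ⌊ β ≟ 0# ⌋)) elems) elems)

    spanDim : Vec n → Vec n → ℕ
    spanDim v w with independent v w
    ... | true  = 2
    ... | false with eqV v zeroV ∧ eqV w zeroV
    ...   | true  = 0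
    ...   | false = 1

    c : ℕ → ℕ
    c k = count (λ { (v , w) → isTriangle zeroV v w ∧ ⌊ spanDim v w Data.Nat.≟ k ⌋ })
                (pairs (allVecs n))

    cardV : ℕ
    cardV = length (allVecs n)

{-# OPTIONS --safe #-}
-- Adjacency in G_{q,a} depends only on q(x − y), so the translations y ↦ y − x are graph
-- automorphisms and every vertex lies on as many triangles as 0.  A triangle {0, v, w} has
-- v ≠ 0, so dim span(v, w) ∈ {1, 2} and 0 lies on c₁ + c₂ triangles.  Counting ordered
-- triangles (x, y, z) therefore gives 6 · #triangles = |V| · 2 (c₁ + c₂).
module Submission where

open import Defs
open import Data.Nat using (ℕ; _+_; _*_)
open import Relation.Binary.PropositionalEquality using (_≡_)

open import Algebra.Bundles using (CommutativeRing)
import Algebra.Properties.AbelianGroup as AbelianGroupProperties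
import Algebra.Properties.Group as GroupProperties
import Algebra.Properties.Ring as RingProperties
open import Data.Bool using (Bool; true; false; not; _∧_)
open import Data.Bool.Properties using (∧-comm; ∧-assoc; ⇔→≡)
open import Data.Empty using (⊥-elim)
open import Data.Fin using () renaming (zero to fzero; suc to fsuc)
open import Data.List using (List; []; _∷_; _++_; map; concatMap; length)
open import Data.List.Membership.Propositional using (_∈_)
open import Data.List.Membership.Propositional.Properties using (∈-map⁺)
open import Data.List.Membership.Propositional.Properties.WithK using (unique∧set⇒bag)
open import Data.List.Properties using (map-∘; map-++)
open import Data.List.Relation.Binary.BagAndSetEquality using (∼bag⇒↭)
open import Data.List.Relation.Binary.Permutation.Propositional using (_↭_)
import Data.List.Relation.Binary.Permutation.Propositional.Properties as ↭
open import Data.List.Relation.Unary.Unique.Propositional using (Unique)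
import Data.List.Relation.Unary.Unique.Propositional.Properties as Unique
import Data.Nat as ℕ
open import Data.Nat.ListAction using (sum)
open import Data.Nat.ListAction.Properties using (sum-++; sum-↭)
open import Data.Nat.Properties using (*-distribˡ-+; *-zeroʳ; *-cancelˡ-≡)
open import Data.Nat.Tactic.RingSolver using (solve-∀)
open import Data.Product using (_×_; _,_; uncurry)
open import Data.Sum using (_⊎_; inj₁; inj₂)
open import Function using (_∘_; _⇔_; mk⇔; _↔_; Inverse; Injection; mk↔ₛ′)
open import Function.Properties.Inverse using (↔⇒↣)
import Function.Properties.Equivalence as ⇔
open import Relation.Binary.Core using (_Preserves_⟶_)
open import Relation.Binary.PropositionalEquality
  using (refl; sym; trans; cong; cong₂; subst; _≗_; module ≡-Reasoning)
open import Relation.Nullary using (yes; no)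
open import Relation.Nullary.Decidable using (⌊_⌋)

open ≡-Reasoning

𝟙[_] : Bool → ℕ
𝟙[ true ]  = 1
𝟙[ false ] = 0

∑ : {A : Set} → List A → (A → ℕ) → ℕ
∑ xs f = sum (map f xs)

syntax ∑ xs (λ x → e) = ∑[ x ∈ xs ] e

module _ {A : Set} where

  ∑-cong : ∀ xs {f g : A → ℕ} → f ≗ g → ∑ xs f ≡ ∑ xs g
  ∑-cong []       f≗g = refl
  ∑-cong (x ∷ xs) f≗g = cong₂ _+_ (f≗g x) (∑-cong xs f≗g)

  ∑-+ : ∀ xs (f g : A → ℕ) → ∑[ x ∈ xs ] (f x + g x) ≡ ∑ xs f + ∑ xs g
  ∑-+ []       f g = refl
  ∑-+ (x ∷ xs) f g rewrite ∑-+ xs f g = interchange (f x) (g x) (∑ xs f) (∑ xs g)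
    where
    interchange : ∀ a b c d → (a + b) + (c + d) ≡ (a + c) + (b + d)
    interchange = solve-∀

  ∑-*ˡ : ∀ xs m (f : A → ℕ) → ∑[ x ∈ xs ] (m * f x) ≡ m * ∑ xs f
  ∑-*ˡ []       m f = sym (*-zeroʳ m)
  ∑-*ˡ (x ∷ xs) m f = trans (cong (m * f x +_) (∑-*ˡ xs m f)) (sym (*-distribˡ-+ m (f x) (∑ xs f)))

  ∑-zero : ∀ xs {f : A → ℕ} → (∀ x → f x ≡ 0) → ∑ xs f ≡ 0
  ∑-zero []       f≡0 = refl
  ∑-zero (x ∷ xs) f≡0 = cong₂ _+_ (f≡0 x) (∑-zero xs f≡0)

  ∑-const : ∀ (xs : List A) k → ∑[ x ∈ xs ] k ≡ length xs * k
  ∑-const []       k = refl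
  ∑-const (x ∷ xs) k = cong (k +_) (∑-const xs k)

  ∑-++ : ∀ xs ys (f : A → ℕ) → ∑ (xs ++ ys) f ≡ ∑ xs f + ∑ ys f
  ∑-++ xs ys f = trans (cong sum (map-++ f xs ys)) (sum-++ (map f xs) (map f ys))

  ∑-map : ∀ {B : Set} (g : B → A) xs (f : A → ℕ) → ∑ (map g xs) f ≡ ∑[ x ∈ xs ] f (g x)
  ∑-map g xs f = cong sum (sym (map-∘ xs))

  ∑-concatMap : ∀ {B : Set} (g : B → List A) xs (f : A → ℕ) →
    ∑ (concatMap g xs) f ≡ ∑[ x ∈ xs ] ∑ (g x) f
  ∑-concatMap g []       f = refl
  ∑-concatMap g (x ∷ xs) f =
    trans (∑-++ (g x) (concatMap g xs) f) (cong (∑ (g x) f +_) (∑-concatMap g xs f))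

  ∑-↔ : ∀ {xs} → Unique xs → (∀ x → x ∈ xs) → (σ : A ↔ A) (f : A → ℕ) →
    ∑[ x ∈ xs ] f (Inverse.to σ x) ≡ ∑ xs f
  ∑-↔ {xs} unique complete σ f = begin
    ∑[ x ∈ xs ] f (to x) ≡⟨ ∑-map to xs f ⟨
    ∑ (map to xs) f      ≡⟨ sum-↭ (↭.map⁺ f map-to-xs↭xs) ⟩
    ∑ xs f               ∎
    where
    open Inverse σ
    map-to-xs↭xs : map to xs ↭ xs
    map-to-xs↭xs = ∼bag⇒↭ (unique∧set⇒bag
      (Unique.map⁺ (Injection.injective (↔⇒↣ σ)) unique) unique
      (λ {y} → mk⇔ (λ _ → complete y)
        (λ _ → subst (_∈ map to xs) (strictlyInverseˡ y) (∈-map⁺ to (complete (from y))))))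

  ∑² : List A → (A → A → ℕ) → ℕ
  ∑² xs k = ∑[ x ∈ xs ] ∑[ y ∈ xs ] k x y

  ∑³ : List A → (A → A → A → ℕ) → ℕ
  ∑³ xs h = ∑[ x ∈ xs ] ∑² xs (h x)

  ∑²-∷ : ∀ w ws {k : A → A → ℕ} → (∀ x y → k x y ≡ k y x) →
    ∑² (w ∷ ws) k ≡ k w w + 2 * ∑[ y ∈ ws ] k w y + ∑² ws k
  ∑²-∷ w ws {k} k-sym = begin
    (k w w + S) + ∑[ x ∈ ws ] (k x w + ∑[ y ∈ ws ] k x y)
      ≡⟨ cong ((k w w + S) +_) (∑-+ ws (λ x → k x w) _) ⟩
    (k w w + S) + (∑[ x ∈ ws ] k x w + ∑² ws k)
      ≡⟨ cong (λ t → (k w w + S) + (t + ∑² ws k)) (∑-cong ws (λ x → k-sym x w)) ⟩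
    (k w w + S) + (S + ∑² ws k)
      ≡⟨ rearrange (k w w) S (∑² ws k) ⟩
    k w w + 2 * S + ∑² ws k ∎
    where
    S : ℕ
    S = ∑[ y ∈ ws ] k w y
    rearrange : ∀ d s r → (d + s) + (s + r) ≡ d + 2 * s + r
    rearrange = solve-∀

module _ (𝔽 : FiniteField) where
  open FiniteField 𝔽 renaming (_+_ to _⊕_; _*_ to _⊗_)

  private
    ring : CommutativeRing _ _
    ring = record { isCommutativeRing = isCommutativeRing }

  open CommutativeRing ring using (+-assoc; *-identityˡ; -‿inverseʳ)
  open RingProperties (CommutativeRing.ring ring) using (-1*x≈-x)
  open AbelianGroupProperties (CommutativeRing.+-abelianGroup ring) using (⁻¹-anti-homo‿-)
  open GroupProperties (CommutativeRing.+-group ring)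
    using (⁻¹-involutive; ∙-cancelʳ; \\-leftDividesʳ; //-rightDividesˡ; //-rightDividesʳ)

  translation : Carrier → Carrier ↔ Carrier
  translation c = mk↔ₛ′ (λ x → x ⊕ - c) (λ x → x ⊕ c) (//-rightDividesʳ c) (//-rightDividesˡ c)

  -1*[y-x]≡x-y : ∀ x y → - 1# ⊗ (y ⊕ - x) ≡ x ⊕ - y
  -1*[y-x]≡x-y x y = trans (-1*x≈-x (y ⊕ - x)) (⁻¹-anti-homo‿- y x)

  -1*-1≡1 : - 1# ⊗ - 1# ≡ 1#
  -1*-1≡1 = trans (-1*x≈-x (- 1#)) (⁻¹-involutive 1#)

  [x-z]-[y-z]≡x-y : ∀ x y z → (x ⊕ - z) ⊕ - (y ⊕ - z) ≡ x ⊕ - y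
  [x-z]-[y-z]≡x-y x y z = begin
    (x ⊕ - z) ⊕ - (y ⊕ - z) ≡⟨ cong ((x ⊕ - z) ⊕_) (⁻¹-anti-homo‿- y z) ⟩
    (x ⊕ - z) ⊕ (z ⊕ - y)   ≡⟨ +-assoc x (- z) (z ⊕ - y) ⟩
    x ⊕ (- z ⊕ (z ⊕ - y))   ≡⟨ cong (x ⊕_) (\\-leftDividesʳ z (- y)) ⟩
    x ⊕ - y                 ∎

  infixl 6 _-ᵛ_
  _-ᵛ_ : ∀ {m} → Vec 𝔽 m → Vec 𝔽 m → Vec 𝔽 m
  _-ᵛ_ = _-V_ 𝔽

  0ᵛ : ∀ {m} → Vec 𝔽 m
  0ᵛ = zeroV 𝔽

  eqV-sound : ∀ {m} (x y : Vec 𝔽 m) → eqV 𝔽 x y ≡ true → x ≗ y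
  eqV-sound {ℕ.suc m} x y eq with x fzero ≟ y fzero
  eqV-sound {ℕ.suc m} x y eq | yes x₀≡y₀ = λ where
    fzero    → x₀≡y₀
    (fsuc i) → eqV-sound (x ∘ fsuc) (y ∘ fsuc) eq i
  eqV-sound {ℕ.suc m} x y () | no _

  eqV-complete : ∀ {m} (x y : Vec 𝔽 m) → x ≗ y → eqV 𝔽 x y ≡ true
  eqV-complete {ℕ.zero}  x y x≗y = refl
  eqV-complete {ℕ.suc m} x y x≗y with x fzero ≟ y fzero
  ... | yes _    = eqV-complete (x ∘ fsuc) (y ∘ fsuc) (x≗y ∘ fsuc)
  ... | no x₀≢y₀ = ⊥-elim (x₀≢y₀ (x≗y fzero))

  eqV⇔≗ : ∀ {m} {x y : Vec 𝔽 m} → eqV 𝔽 x y ≡ true ⇔ x ≗ y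
  eqV⇔≗ = mk⇔ (eqV-sound _ _) (eqV-complete _ _)

  eqV-cong : ∀ {m} {x y x′ y′ : Vec 𝔽 m} → x ≗ y ⇔ x′ ≗ y′ → eqV 𝔽 x y ≡ eqV 𝔽 x′ y′
  eqV-cong x≗y⇔x′≗y′ = ⇔→≡ (⇔.trans eqV⇔≗ (⇔.trans x≗y⇔x′≗y′ (⇔.sym eqV⇔≗)))

  eqV-sym : ∀ {m} (x y : Vec 𝔽 m) → eqV 𝔽 x y ≡ eqV 𝔽 y x
  eqV-sym x y = eqV-cong {x = x} {y} (mk⇔ (λ x≗y → sym ∘ x≗y) (λ y≗x → sym ∘ y≗x))

  q-sub-comm : ∀ {m} (Q : QuadraticForm 𝔽 m) (x y : Vec 𝔽 m) → q Q (x -ᵛ y) ≡ q Q (y -ᵛ x)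
  q-sub-comm Q x y = begin
    q Q (x -ᵛ y)                   ≡⟨ q-cong Q _ _ (λ i → sym (-1*[y-x]≡x-y (x i) (y i))) ⟩
    q Q (_·V_ 𝔽 (- 1#) (y -ᵛ x))   ≡⟨ q-homog Q (- 1#) (y -ᵛ x) ⟩
    (- 1# ⊗ - 1#) ⊗ q Q (y -ᵛ x)   ≡⟨ cong (_⊗ q Q (y -ᵛ x)) -1*-1≡1 ⟩
    1# ⊗ q Q (y -ᵛ x)              ≡⟨ *-identityˡ _ ⟩
    q Q (y -ᵛ x)                   ∎

  ∑-allVecs-suc : ∀ m (g : Vec 𝔽 (ℕ.suc m) → ℕ) →
    ∑ (allVecs 𝔽 (ℕ.suc m)) g ≡ ∑[ c ∈ elems ] ∑[ v ∈ allVecs 𝔽 m ] g (cons 𝔽 c v)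
  ∑-allVecs-suc m g = trans (∑-concatMap _ elems g)
                            (∑-cong elems (λ c → ∑-map (cons 𝔽 c) (allVecs 𝔽 m) g))

  ∑-allVecs-translate : ∀ m {g : Vec 𝔽 m → ℕ} → g Preserves _≗_ ⟶ _≡_ → ∀ x →
    ∑[ y ∈ allVecs 𝔽 m ] g (y -ᵛ x) ≡ ∑ (allVecs 𝔽 m) g
  ∑-allVecs-translate ℕ.zero    g-resp x = cong (_+ 0) (g-resp (λ ()))
  ∑-allVecs-translate (ℕ.suc m) {g} g-resp x = begin
    ∑[ y ∈ allVecs 𝔽 (ℕ.suc m) ] g (y -ᵛ x)
      ≡⟨ ∑-allVecs-suc m _ ⟩
    ∑[ c ∈ elems ] ∑[ v ∈ allVecs 𝔽 m ] g (cons 𝔽 c v -ᵛ x)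
      ≡⟨ ∑-cong elems (λ c → ∑-cong (allVecs 𝔽 m) (λ v → g-resp (cons-sub c v))) ⟩
    ∑[ c ∈ elems ] ∑[ v ∈ allVecs 𝔽 m ] g (cons 𝔽 (c ⊕ - x₀) (v -ᵛ x′))
      ≡⟨ ∑-cong elems (λ c → ∑-allVecs-translate m (λ u≗v → g-resp (cons-cong u≗v)) x′) ⟩
    ∑[ c ∈ elems ] G (c ⊕ - x₀)
      ≡⟨ ∑-↔ unique complete (translation x₀) G ⟩
    ∑[ c ∈ elems ] G c
      ≡⟨ ∑-allVecs-suc m g ⟨
    ∑ (allVecs 𝔽 (ℕ.suc m)) g ∎
    where
    x₀ : Carrier
    x₀ = x fzero
    x′ : Vec 𝔽 m
    x′ = x ∘ fsuc
    G : Carrier → ℕ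
    G c = ∑[ v ∈ allVecs 𝔽 m ] g (cons 𝔽 c v)
    cons-sub : ∀ c v → cons 𝔽 c v -ᵛ x ≗ cons 𝔽 (c ⊕ - x₀) (v -ᵛ x′)
    cons-sub c v fzero    = refl
    cons-sub c v (fsuc i) = refl
    cons-cong : ∀ {c} {u v : Vec 𝔽 m} → u ≗ v → cons 𝔽 c u ≗ cons 𝔽 c v
    cons-cong u≗v fzero    = refl
    cons-cong u≗v (fsuc i) = u≗v i

  -- pairs, triples and count live in Graph although they do not depend on its parameters.
  module _ {n : ℕ} (Q : QuadraticForm 𝔽 n) (a : Carrier) where
    open Graph 𝔽 Q a

    count-∑ : ∀ {A : Set} (p : A → Bool) xs → count p xs ≡ ∑[ x ∈ xs ] 𝟙[ p x ]
    count-∑ p []       = refl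
    count-∑ p (x ∷ xs) with p x
    ... | true  = cong ℕ.suc (count-∑ p xs)
    ... | false = count-∑ p xs

    ∑-pairs-∷ : ∀ {A : Set} (w : A) ws (f : A × A → ℕ) →
      ∑ (pairs (w ∷ ws)) f ≡ ∑[ y ∈ ws ] f (w , y) + ∑ (pairs ws) f
    ∑-pairs-∷ w ws f =
      trans (∑-++ (map (w ,_) ws) (pairs ws) f) (cong (_+ ∑ (pairs ws) f) (∑-map (w ,_) ws f))

    ∑-triples-∷ : ∀ {A : Set} (w : A) ws (f : A × A × A → ℕ) →
      ∑ (triples (w ∷ ws)) f ≡ ∑ (pairs ws) (λ (y , z) → f (w , y , z)) + ∑ (triples ws) f
    ∑-triples-∷ w ws f =
      trans (∑-++ (map _ (pairs ws)) (triples ws) f)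
            (cong (_+ ∑ (triples ws) f) (∑-map _ (pairs ws) f))

    ∑²-pairs : ∀ {A : Set} (xs : List A) {k : A → A → ℕ} →
      (∀ x y → k x y ≡ k y x) → (∀ x → k x x ≡ 0) → ∑² xs k ≡ 2 * ∑ (pairs xs) (uncurry k)
    ∑²-pairs []       k-sym k-diag = refl
    ∑²-pairs (w ∷ ws) {k} k-sym k-diag = begin
      ∑² (w ∷ ws) k
        ≡⟨ ∑²-∷ w ws k-sym ⟩
      k w w + 2 * S + ∑² ws k
        ≡⟨ cong₂ (λ d p → d + 2 * S + p) (k-diag w) (∑²-pairs ws k-sym k-diag) ⟩
      0 + 2 * S + 2 * P
        ≡⟨ collect S P ⟩
      2 * (S + P)
        ≡⟨ cong (2 *_) (∑-pairs-∷ w ws (uncurry k)) ⟨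
      2 * ∑ (pairs (w ∷ ws)) (uncurry k) ∎
      where
      S P : ℕ
      S = ∑[ y ∈ ws ] k w y
      P = ∑ (pairs ws) (uncurry k)
      collect : ∀ s p → 0 + 2 * s + 2 * p ≡ 2 * (s + p)
      collect = solve-∀

    ∑³-triples : ∀ {A : Set} (xs : List A) {h : A → A → A → ℕ} →
      (∀ x y z → h x y z ≡ h y x z) → (∀ x y z → h x y z ≡ h x z y) → (∀ x z → h x x z ≡ 0) →
      ∑³ xs h ≡ 6 * ∑ (triples xs) (λ (x , y , z) → h x y z)
    ∑³-triples []       swap₁₂ swap₂₃ diag = refl
    -- Split x, y, z by whether they equal the head w: terms with two w's vanish, and each of
    -- the three positions for a single w contributes ∑² ws (h w) = 2P.
    ∑³-triples (w ∷ ws) {h} swap₁₂ swap₂₃ diag = begin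
      ∑³ (w ∷ ws) h
        ≡⟨ ∑-cong (w ∷ ws) (λ x → ∑²-∷ w ws (swap₂₃ x)) ⟩
      ∑[ x ∈ w ∷ ws ] (h x w w + 2 * ∑[ z ∈ ws ] h x w z + ∑² ws (h x))
        ≡⟨ ∑-+ (w ∷ ws) (λ x → h x w w + 2 * ∑[ z ∈ ws ] h x w z) (λ x → ∑² ws (h x)) ⟩
      ∑[ x ∈ w ∷ ws ] (h x w w + 2 * ∑[ z ∈ ws ] h x w z) + (∑² ws (h w) + ∑³ ws h)
        ≡⟨ cong (_+ (∑² ws (h w) + ∑³ ws h))
             (trans (∑-+ (w ∷ ws) (λ x → h x w w) _)
                    (cong (D +_) (∑-*ˡ (w ∷ ws) 2 (λ x → ∑[ z ∈ ws ] h x w z)))) ⟩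
      D + 2 * C + (∑² ws (h w) + ∑³ ws h)
        ≡⟨ cong₂ _+_ (cong₂ (λ d c → d + 2 * c) diagonal cross)
                     (cong₂ _+_ pairs-through-w (∑³-triples ws swap₁₂ swap₂₃ diag)) ⟩
      0 + 2 * (2 * P) + (2 * P + 6 * T)
        ≡⟨ collect P T ⟩
      6 * (P + T)
        ≡⟨ cong (6 *_) (∑-triples-∷ w ws _) ⟨
      6 * ∑ (triples (w ∷ ws)) (λ (x , y , z) → h x y z) ∎
      where
      D C P T : ℕ
      D = ∑[ x ∈ w ∷ ws ] h x w w
      C = ∑[ x ∈ w ∷ ws ] ∑[ z ∈ ws ] h x w z
      P = ∑ (pairs ws) (uncurry (h w))
      T = ∑ (triples ws) (λ (x , y , z) → h x y z)
      vanish₂₃ : ∀ x y → h x y y ≡ 0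
      vanish₂₃ x y = trans (swap₁₂ x y y) (trans (swap₂₃ y x y) (diag y x))
      pairs-through-w : ∑² ws (h w) ≡ 2 * P
      pairs-through-w = ∑²-pairs ws (swap₂₃ w) (vanish₂₃ w)
      diagonal : D ≡ 0
      diagonal = ∑-zero (w ∷ ws) (λ x → vanish₂₃ x w)
      cross : C ≡ 2 * P
      cross = trans (cong₂ _+_ (∑-zero ws (diag w)) (∑-cong ws (λ x → ∑-cong ws (swap₁₂ x w))))
                    pairs-through-w
      collect : ∀ p t → 0 + 2 * (2 * p) + (2 * p + 6 * t) ≡ 6 * (p + t)
      collect = solve-∀

    adj-cong : ∀ {x y x′ y′ : Vec 𝔽 n} → x ≗ y ⇔ x′ ≗ y′ → q Q (x -ᵛ y) ≡ q Q (x′ -ᵛ y′) →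
      adj x y ≡ adj x′ y′
    adj-cong x≗y⇔x′≗y′ = cong₂ (λ e r → not e ∧ ⌊ r ≟ a ⌋) (eqV-cong x≗y⇔x′≗y′)

    adj-resp : ∀ {x y x′ y′ : Vec 𝔽 n} → x ≗ x′ → y ≗ y′ → adj x y ≡ adj x′ y′
    adj-resp x≗x′ y≗y′ = adj-cong
      (mk⇔ (λ x≗y i → trans (sym (x≗x′ i)) (trans (x≗y i) (y≗y′ i)))
           (λ x′≗y′ i → trans (x≗x′ i) (trans (x′≗y′ i) (sym (y≗y′ i)))))
      (q-cong Q _ _ (λ i → cong₂ (λ s t → s ⊕ - t) (x≗x′ i) (y≗y′ i)))

    adj-sym : ∀ x y → adj x y ≡ adj y x
    adj-sym x y = cong₂ (λ e r → not e ∧ ⌊ r ≟ a ⌋) (eqV-sym x y) (q-sub-comm Q x y)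

    adj-irrefl : ∀ x → adj x x ≡ false
    adj-irrefl x rewrite eqV-complete x x (λ _ → refl) = refl

    adj-translate : ∀ x y z → adj (x -ᵛ z) (y -ᵛ z) ≡ adj x y
    adj-translate x y z = adj-cong
      (mk⇔ (λ e i → ∙-cancelʳ (- z i) (x i) (y i) (e i)) (λ e i → cong (_⊕ - z i) (e i)))
      (q-cong Q _ _ (λ i → [x-z]-[y-z]≡x-y (x i) (y i) (z i)))

    isTriangle-resp : ∀ {x y z x′ y′ z′ : Vec 𝔽 n} → x ≗ x′ → y ≗ y′ → z ≗ z′ →
      isTriangle x y z ≡ isTriangle x′ y′ z′
    isTriangle-resp x≗x′ y≗y′ z≗z′ =
      cong₂ _∧_ (adj-resp x≗x′ y≗y′) (cong₂ _∧_ (adj-resp y≗y′ z≗z′) (adj-resp x≗x′ z≗z′))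

    isTriangle-swap₁₂ : ∀ x y z → isTriangle x y z ≡ isTriangle y x z
    isTriangle-swap₁₂ x y z =
      cong₂ (λ xy yz∧xz → xy ∧ yz∧xz) (adj-sym x y) (∧-comm (adj y z) (adj x z))

    isTriangle-swap₂₃ : ∀ x y z → isTriangle x y z ≡ isTriangle x z y
    isTriangle-swap₂₃ x y z = begin
      adj x y ∧ (adj y z ∧ adj x z) ≡⟨ ∧-comm (adj x y) _ ⟩
      (adj y z ∧ adj x z) ∧ adj x y ≡⟨ cong (λ b → (b ∧ adj x z) ∧ adj x y) (adj-sym y z) ⟩
      (adj z y ∧ adj x z) ∧ adj x y ≡⟨ cong (_∧ adj x y) (∧-comm (adj z y) (adj x z)) ⟩
      (adj x z ∧ adj z y) ∧ adj x y ≡⟨ ∧-assoc (adj x z) _ _ ⟩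
      adj x z ∧ (adj z y ∧ adj x y) ∎

    isTriangle-diag : ∀ x z → isTriangle x x z ≡ false
    isTriangle-diag x z = cong (_∧ (adj x z ∧ adj x z)) (adj-irrefl x)

    isTriangle-translate : ∀ x y z w → isTriangle (x -ᵛ w) (y -ᵛ w) (z -ᵛ w) ≡ isTriangle x y z
    isTriangle-translate x y z w =
      cong₂ _∧_ (adj-translate x y w) (cong₂ _∧_ (adj-translate y z w) (adj-translate x z w))

    vertices : List (Vec 𝔽 n)
    vertices = allVecs 𝔽 n

    trianglesAt : Vec 𝔽 n → ℕ
    trianglesAt x = ∑² vertices (λ y z → 𝟙[ isTriangle x y z ])

    trianglesAt-invariant : ∀ x → trianglesAt x ≡ trianglesAt 0ᵛ
    trianglesAt-invariant x = begin
      ∑[ y ∈ vertices ] ∑[ z ∈ vertices ] 𝟙[ isTriangle x y z ]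
        ≡⟨ ∑-cong vertices (λ y → ∑-cong vertices (λ z → cong 𝟙[_] (move-x-to-0 y z))) ⟩
      ∑[ y ∈ vertices ] ∑[ z ∈ vertices ] 𝟙[ isTriangle 0ᵛ (y -ᵛ x) (z -ᵛ x) ]
        ≡⟨ ∑-cong vertices (λ y → ∑-allVecs-translate n
             (λ z≗z′ → cong 𝟙[_] (isTriangle-resp ≗-refl ≗-refl z≗z′)) x) ⟩
      ∑[ y ∈ vertices ] ∑[ z ∈ vertices ] 𝟙[ isTriangle 0ᵛ (y -ᵛ x) z ]
        ≡⟨ ∑-allVecs-translate n
             (λ y≗y′ → ∑-cong vertices (λ z → cong 𝟙[_] (isTriangle-resp ≗-refl y≗y′ ≗-refl))) x ⟩
      ∑[ y ∈ vertices ] ∑[ z ∈ vertices ] 𝟙[ isTriangle 0ᵛ y z ] ∎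
      where
      ≗-refl : ∀ {v : Vec 𝔽 n} → v ≗ v
      ≗-refl _ = refl
      move-x-to-0 : ∀ y z → isTriangle x y z ≡ isTriangle 0ᵛ (y -ᵛ x) (z -ᵛ x)
      move-x-to-0 y z = trans (sym (isTriangle-translate x y z x))
                              (isTriangle-resp (-‿inverseʳ ∘ x) ≗-refl ≗-refl)

    6*numTriangles≡∑-trianglesAt : 6 * numTriangles ≡ ∑ vertices trianglesAt
    6*numTriangles≡∑-trianglesAt = begin
      6 * numTriangles
        ≡⟨ cong (6 *_) (count-∑ _ (triples vertices)) ⟩
      6 * ∑ (triples vertices) (λ (x , y , z) → 𝟙[ isTriangle x y z ])
        ≡⟨ ∑³-triples vertices (λ x y z → cong 𝟙[_] (isTriangle-swap₁₂ x y z))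
                               (λ x y z → cong 𝟙[_] (isTriangle-swap₂₃ x y z))
                               (λ x z → cong 𝟙[_] (isTriangle-diag x z)) ⟨
      ∑ vertices trianglesAt ∎

    triangle-at-0-nonzero : ∀ v w → isTriangle 0ᵛ v w ≡ true → eqV 𝔽 v 0ᵛ ≡ false
    triangle-at-0-nonzero v w triangle with eqV 𝔽 v 0ᵛ in v≡0
    ... | false = refl
    ... | true  with () ← trans (sym triangle)
                   (trans (isTriangle-resp (λ _ → refl) (eqV-sound v 0ᵛ v≡0) (λ _ → refl))
                          (isTriangle-diag 0ᵛ w))

    spanDim-nonzero : ∀ v w → eqV 𝔽 v 0ᵛ ≡ false → spanDim v w ≡ 1 ⊎ spanDim v w ≡ 2
    spanDim-nonzero v w v≢0 with independent v w
    ... | true  = inj₂ refl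
    ... | false rewrite v≢0 = inj₁ refl

    split-by-spanDim : ∀ v w →
      𝟙[ isTriangle 0ᵛ v w ∧ ⌊ spanDim v w ℕ.≟ 1 ⌋ ] +
      𝟙[ isTriangle 0ᵛ v w ∧ ⌊ spanDim v w ℕ.≟ 2 ⌋ ] ≡ 𝟙[ isTriangle 0ᵛ v w ]
    split-by-spanDim v w with isTriangle 0ᵛ v w in triangle
    ... | false = refl
    ... | true with spanDim-nonzero v w (triangle-at-0-nonzero v w triangle)
    ...   | inj₁ dim≡1 rewrite dim≡1 = refl
    ...   | inj₂ dim≡2 rewrite dim≡2 = refl

    c₁+c₂≡∑-triangles-at-0 :
      c 1 + c 2 ≡ ∑ (pairs vertices) (λ (v , w) → 𝟙[ isTriangle 0ᵛ v w ])
    c₁+c₂≡∑-triangles-at-0 = begin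
      c 1 + c 2
        ≡⟨ cong₂ _+_ (count-∑ _ (pairs vertices)) (count-∑ _ (pairs vertices)) ⟩
      ∑ (pairs vertices) (triangleOfDim 1) + ∑ (pairs vertices) (triangleOfDim 2)
        ≡⟨ ∑-+ (pairs vertices) (triangleOfDim 1) (triangleOfDim 2) ⟨
      ∑ (pairs vertices) (λ vw → triangleOfDim 1 vw + triangleOfDim 2 vw)
        ≡⟨ ∑-cong (pairs vertices) (λ (v , w) → split-by-spanDim v w) ⟩
      ∑ (pairs vertices) (λ (v , w) → 𝟙[ isTriangle 0ᵛ v w ]) ∎
      where
      triangleOfDim : ℕ → Vec 𝔽 n × Vec 𝔽 n → ℕ
      triangleOfDim k (v , w) = 𝟙[ isTriangle 0ᵛ v w ∧ ⌊ spanDim v w ℕ.≟ k ⌋ ]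

    trianglesAt-0 : trianglesAt 0ᵛ ≡ 2 * (c 1 + c 2)
    trianglesAt-0 = begin
      ∑² vertices (λ v w → 𝟙[ isTriangle 0ᵛ v w ])
        ≡⟨ ∑²-pairs vertices (λ v w → cong 𝟙[_] (isTriangle-swap₂₃ 0ᵛ v w)) 0vv-empty ⟩
      2 * ∑ (pairs vertices) (λ (v , w) → 𝟙[ isTriangle 0ᵛ v w ])
        ≡⟨ cong (2 *_) c₁+c₂≡∑-triangles-at-0 ⟨
      2 * (c 1 + c 2) ∎
      where
      0vv-empty : ∀ v → 𝟙[ isTriangle 0ᵛ v v ] ≡ 0
      0vv-empty v = cong 𝟙[_] (trans (isTriangle-swap₁₂ 0ᵛ v v)
                                (trans (isTriangle-swap₂₃ v 0ᵛ v) (isTriangle-diag v 0ᵛ)))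

    6*numTriangles≡cardV*2[c₁+c₂] : 6 * numTriangles ≡ cardV * (2 * (c 1 + c 2))
    6*numTriangles≡cardV*2[c₁+c₂] = begin
      6 * numTriangles                      ≡⟨ 6*numTriangles≡∑-trianglesAt ⟩
      ∑[ x ∈ vertices ] trianglesAt x       ≡⟨ ∑-cong vertices trianglesAt-invariant ⟩
      ∑[ x ∈ vertices ] trianglesAt 0ᵛ      ≡⟨ ∑-const vertices (trianglesAt 0ᵛ) ⟩
      cardV * trianglesAt 0ᵛ                ≡⟨ cong (cardV *_) trianglesAt-0 ⟩
      cardV * (2 * (c 1 + c 2))             ∎

proposition4p3 : (𝔽 : FiniteField) (n : ℕ) (Q : QuadraticForm 𝔽 n) →
    NonDegenerate 𝔽 Q → (a : FiniteField.Carrier 𝔽) → InD~ 𝔽 Q a →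
    3 * Graph.numTriangles 𝔽 Q a ≡ (Graph.c 𝔽 Q a 1 + Graph.c 𝔽 Q a 2) * Graph.cardV 𝔽 Q a
proposition4p3 𝔽 n Q _ a _ = *-cancelˡ-≡ _ _ 2 (begin
  2 * (3 * T)          ≡⟨ regroup T ⟩
  6 * T                ≡⟨ 6*numTriangles≡cardV*2[c₁+c₂] 𝔽 Q a ⟩
  cardV * (2 * C)      ≡⟨ regroup′ cardV C ⟩
  2 * (C * cardV)      ∎)
  where
  open Graph 𝔽 Q a using (cardV)
  T C : ℕ
  T = Graph.numTriangles 𝔽 Q a
  C = Graph.c 𝔽 Q a 1 + Graph.c 𝔽 Q a 2
  regroup : ∀ t → 2 * (3 * t) ≡ 6 * t
  regroup = solve-∀
  regroup′ : ∀ v c → v * (2 * c) ≡ 2 * (c * v)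
  regroup′ = solve-∀
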